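{- Let $P=\forall X\forall Y(((X\to Y)\to X)\to X)$ and $Q=P\to\forall X\,X$. Then (1) $Q\to P$ is not provable in the logical system $\mathcal{F}$, i.e. $\not\vdash_{\mathcal{F}}Q\to P$; (2) $(Q\to P)\to Q$ is not provable in the system $\mathcal{F}_C$, i.e. $\not\vdash_{\mathcal{F}_C}(Q\to P)\to Q$.
   Context: System $\mathcal{F}$: formulas/types are built from variables and a constant $\perp$ with $\to$ and second-order $\forall X$; $\neg A$ abbreviates $A\to\perp$. The logical system $\mathcal{F}$ is intuitionistic second-order propositional logic with rules: axiom, $\to$-introduction, $\to$-elimination, $\forall$-introduction (variable not free in hypotheses), $\forall$-elimination (instantiation by any formula); $\Gamma\vdash_{\mathcal{F}}A$ means $A$ is derivable from $\Gamma$ (equivalently, some $\lambda$-term has type $A$ in the corresponding context). $\mathcal{F}_C$ is $\mathcal{F}$ extended with the rule: from $\Gamma\vdash\neg\neg A$ infer $\Gamma\vdash A$. -}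

module Defs where

open import Data.Nat using (ℕ; zero; suc; _<ᵇ_; _≡ᵇ_; pred)
open import Data.Bool using (if_then_else_)
open import Data.List using (List; []; _∷_; map)
open import Data.List.Membership.Propositional using (_∈_)
open import Relation.Binary.PropositionalEquality using (_≡_)

-- Formulas of second-order propositional logic (system F types),
-- with de Bruijn indices for propositional variables.
-- Free variables are the indices not bound by an enclosing ∀.
infixr 6 _⇒_
data Form : Set where
  var  : ℕ → Form
  ⊥'   : Form
  _⇒_  : Form → Form → Form
  ∀'   : Form → Form

¬' : Form → Form
¬' A = A ⇒ ⊥'

shift : ℕ → Form → Form
shift c (var n) = if n <ᵇ c then var n else var (suc n)
shift c ⊥' = ⊥'
shift c (A ⇒ B) = shift c A ⇒ shift c B
shift c (∀' A) = ∀' (shift (suc c) A)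

-- capture-avoiding substitution of B for variable k, decrementing
-- the variables above k (B lives in the context outside the binder at k)
shiftN : ℕ → Form → Form
shiftN zero C = C
shiftN (suc m) C = shift 0 (shiftN m C)

substVar : ℕ → Form → ℕ → Form
substVar k B n = if n <ᵇ k then var n
                 else (if n ≡ᵇ k then shiftN k B else var (pred n))

subst' : ℕ → Form → Form → Form
subst' k B (var n) = substVar k B n
subst' k B ⊥' = ⊥'
subst' k B (A ⇒ C) = subst' k B A ⇒ subst' k B C
subst' k B (∀' A) = ∀' (subst' (suc k) B A)

_[_] : Form → Form → Form
A [ B ] = subst' 0 B A

Ctx : Set
Ctx = List Form

-- The ∀-introduction side condition (X not free in Γ)
-- is implemented in de Bruijn style: the premise is derived in the
-- context with all free variables of Γ shifted past the new variable 0.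
-- The index s ∈ {F, FC} says whether the classical ¬¬-rule (F_C) is available.
data Sys : Set where
  F FC : Sys

infix 3 _⊢[_]_
data _⊢[_]_ : Ctx → Sys → Form → Set where
  ax   : ∀ {s Γ A} → A ∈ Γ → Γ ⊢[ s ] A
  ⇒I   : ∀ {s Γ A B} → (A ∷ Γ) ⊢[ s ] B → Γ ⊢[ s ] A ⇒ B
  ⇒E   : ∀ {s Γ A B} → Γ ⊢[ s ] A ⇒ B → Γ ⊢[ s ] A → Γ ⊢[ s ] B
  ∀I   : ∀ {s Γ A} → map (shift 0) Γ ⊢[ s ] A → Γ ⊢[ s ] ∀' A
  ∀E   : ∀ {s Γ A} → Γ ⊢[ s ] ∀' A → (B : Form) → Γ ⊢[ s ] A [ B ]
  ¬¬E  : ∀ {Γ A} → Γ ⊢[ FC ] ¬' (¬' A) → Γ ⊢[ FC ] A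

-- P = ∀X∀Y(((X→Y)→X)→X)   (X = index 1, Y = index 0 inside)
P : Form
P = ∀' (∀' (((var 1 ⇒ var 0) ⇒ var 1) ⇒ var 1))

Q : Form
Q = P ⇒ ∀' (var 0)

-- Both parts are countermodel arguments, for a Kripke semantics whose
-- quantifiers range over a set of codes of upward-closed truth values. Working
-- constructively, the codes need to represent every upset only up to double
-- negation: every formula denotes a ¬¬-stable predicate, which is all that
-- ∀-elimination needs. The classical rule of F_C is sound in symmetric frames.
--
-- (1) On (ℕ, ≤) with the principal upsets and ∅ as codes, P fails everywhere:
-- at world w take X = [w+1, ∞) and Y = ∅; then X → Y fails at every world, so
-- (X → Y) → X holds at w while X does not. Hence Q holds at 0 and Q → P fails.
-- (2) In the one-world two-valued model P is Peirce's law, hence true, so Q is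
-- false and (Q → P) → Q is false.
module Submission where

open import Defs
open import Data.Bool using (Bool; true; false; if_then_else_)
open import Data.Empty using (⊥-elim)
open import Data.List using ([])
open import Data.List.Relation.Unary.All as All using (All; [])
open import Data.List.Relation.Unary.All.Properties using (map⁺)
open import Data.Maybe using (Maybe; just; nothing)
open import Data.Nat using (ℕ; zero; suc; _≤_; _≤?_; _<ᵇ_; _≡ᵇ_; pred; s≤s; z≤n)
open import Data.Nat.Properties using (≤-refl; ≤-trans; n≤1+n; <-irrefl; ≰⇒>)
open import Data.Product using (Σ; _×_; _,_; proj₁; proj₂)
open import Data.Unit using (⊤; tt)
open import Effect.Monad using (RawMonad)
open import Level using (0ℓ)
open import Relation.Binary.Definitions using (Reflexive; Transitive; Symmetric; _Respects_)
open import Relation.Binary.PropositionalEquality using (_≡_; refl)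
open import Relation.Nullary using (¬_; yes; no)
open import Relation.Nullary.Decidable using (decidable-stable; ¬¬-excluded-middle)
open import Relation.Nullary.Negation using (¬¬-Monad)
open import Relation.Unary using (Pred; ∅; U; _≐_; Stable)
open import Relation.Unary.Properties using (≐-refl; ≐-trans)

open RawMonad (¬¬-Monad {0ℓ}) using (pure; _<$>_; _>>=_)

record Frame : Set₁ where
  field
    World         : Set
    _≼_           : World → World → Set
    ≼-refl        : Reflexive _≼_
    ≼-trans       : Transitive _≼_
    Code          : Set
    ⟪_⟫           : Code → Pred World 0ℓ
    ⟪⟫-upward     : ∀ c → ⟪ c ⟫ Respects _≼_
    ⟪⟫-stable     : ∀ c → Stable ⟪ c ⟫
    comprehension : (p : Pred World 0ℓ) → p Respects _≼_ →
                    ¬ ¬ (Σ Code λ c → p ≐ ⟪ c ⟫)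

module Semantics (𝔽 : Frame) where
  open Frame 𝔽

  Env : Set
  Env = ℕ → Code

  infixr 5 _∷ₑ_
  _∷ₑ_ : Code → Env → Env
  (c ∷ₑ ρ) zero    = c
  (c ∷ₑ ρ) (suc n) = ρ n

  delete : ℕ → Env → Env
  delete k ρ n = if n <ᵇ k then ρ n else ρ (suc n)

  insert : ℕ → Code → Env → Env
  insert k c ρ n = if n <ᵇ k then ρ n else (if n ≡ᵇ k then c else ρ (pred n))

  infixr 6 _⇛_
  _⇛_ : Pred World 0ℓ → Pred World 0ℓ → Pred World 0ℓ
  (p ⇛ q) w = ∀ {w′} → w ≼ w′ → p w′ → q w′

  ⋀ : (Code → Pred World 0ℓ) → Pred World 0ℓ
  ⋀ p w = ∀ c → p c w

  ⟦_⟧ : Form → Env → Pred World 0ℓ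
  ⟦ var n ⟧  ρ = ⟪ ρ n ⟫
  ⟦ ⊥' ⟧     ρ = ∅
  ⟦ A ⇒ B ⟧  ρ = ⟦ A ⟧ ρ ⇛ ⟦ B ⟧ ρ
  ⟦ ∀' A ⟧   ρ = ⋀ λ c → ⟦ A ⟧ (c ∷ₑ ρ)

  ⟦⟧-upward : ∀ A ρ → ⟦ A ⟧ ρ Respects _≼_
  ⟦⟧-upward (var n) ρ w≼w′ x = ⟪⟫-upward (ρ n) w≼w′ x
  ⟦⟧-upward ⊥'      ρ w≼w′ ()
  ⟦⟧-upward (A ⇒ B) ρ w≼w′ f = λ w′≼w″ → f (≼-trans w≼w′ w′≼w″)
  ⟦⟧-upward (∀' A)  ρ w≼w′ f = λ c → ⟦⟧-upward A (c ∷ₑ ρ) w≼w′ (f c)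

  ⟦⟧-stable : ∀ A ρ → Stable (⟦ A ⟧ ρ)
  ⟦⟧-stable (var n) ρ w ¬¬x = ⟪⟫-stable (ρ n) w ¬¬x
  ⟦⟧-stable ⊥'      ρ w ¬¬x = ¬¬x λ ()
  ⟦⟧-stable (A ⇒ B) ρ w ¬¬f {w′} w≼w′ a =
    ⟦⟧-stable B ρ w′ λ ¬b → ¬¬f λ f → ¬b (f w≼w′ a)
  ⟦⟧-stable (∀' A)  ρ w ¬¬f c =
    ⟦⟧-stable A (c ∷ₑ ρ) w λ ¬a → ¬¬f λ f → ¬a (f c)

  ⇛-cong : ∀ {p p′ q q′} → p ≐ p′ → q ≐ q′ → (p ⇛ q) ≐ (p′ ⇛ q′)
  ⇛-cong (p⊆p′ , p′⊆p) (q⊆q′ , q′⊆q) =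
    (λ f w≼w′ x → q⊆q′ (f w≼w′ (p′⊆p x))) ,
    (λ f w≼w′ x → q′⊆q (f w≼w′ (p⊆p′ x)))

  ⋀-cong : ∀ {p q} → (∀ c → p c ≐ q c) → ⋀ p ≐ ⋀ q
  ⋀-cong p≐q = (λ f c → proj₁ (p≐q c) (f c)) , (λ f c → proj₂ (p≐q c) (f c))

  ⟦⟧-env-ext : ∀ A {ρ σ} → (∀ n → ρ n ≡ σ n) → ⟦ A ⟧ ρ ≐ ⟦ A ⟧ σ
  ⟦⟧-env-ext (var n) ρ≗σ rewrite ρ≗σ n = ≐-refl
  ⟦⟧-env-ext ⊥'      ρ≗σ = ≐-refl
  ⟦⟧-env-ext (A ⇒ B) ρ≗σ = ⇛-cong (⟦⟧-env-ext A ρ≗σ) (⟦⟧-env-ext B ρ≗σ)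
  ⟦⟧-env-ext (∀' A) {ρ} {σ} ρ≗σ = ⋀-cong λ c → ⟦⟧-env-ext A (∷ₑ-cong c)
    where
    ∷ₑ-cong : ∀ c n → (c ∷ₑ ρ) n ≡ (c ∷ₑ σ) n
    ∷ₑ-cong c zero    = refl
    ∷ₑ-cong c (suc n) = ρ≗σ n

  ⟦shift⟧ : ∀ A k ρ → ⟦ shift k A ⟧ ρ ≐ ⟦ A ⟧ (delete k ρ)
  ⟦shift⟧ (var n) k ρ with n <ᵇ k
  ... | true  = ≐-refl
  ... | false = ≐-refl
  ⟦shift⟧ ⊥'      k ρ = ≐-refl
  ⟦shift⟧ (A ⇒ B) k ρ = ⇛-cong (⟦shift⟧ A k ρ) (⟦shift⟧ B k ρ)
  ⟦shift⟧ (∀' A)  k ρ =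
    ⋀-cong λ c → ≐-trans (⟦shift⟧ A (suc k) (c ∷ₑ ρ)) (⟦⟧-env-ext A (delete-suc c))
    where
    delete-suc : ∀ c n → delete (suc k) (c ∷ₑ ρ) n ≡ (c ∷ₑ delete k ρ) n
    delete-suc c zero = refl
    delete-suc c (suc n) with n <ᵇ k
    ... | true  = refl
    ... | false = refl

  insert-suc : ∀ k c ρ d n → insert (suc k) c (d ∷ₑ ρ) n ≡ (d ∷ₑ insert k c ρ) n
  insert-suc k       c ρ d zero = refl
  insert-suc zero    c ρ d (suc zero) = refl
  insert-suc (suc k) c ρ d (suc zero) = refl
  insert-suc k       c ρ d (suc (suc n)) with suc n <ᵇ k | suc n ≡ᵇ k
  ... | true  | _     = refl
  ... | false | true  = refl
  ... | false | false = refl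

  ⟦subst⟧ : ∀ A k B c ρ → ⟦ shiftN k B ⟧ ρ ≐ ⟪ c ⟫ →
            ⟦ subst' k B A ⟧ ρ ≐ ⟦ A ⟧ (insert k c ρ)
  ⟦subst⟧ (var n) k B c ρ B≐c with n <ᵇ k | n ≡ᵇ k
  ... | true  | _     = ≐-refl
  ... | false | true  = B≐c
  ... | false | false = ≐-refl
  ⟦subst⟧ ⊥'      k B c ρ B≐c = ≐-refl
  ⟦subst⟧ (A ⇒ C) k B c ρ B≐c = ⇛-cong (⟦subst⟧ A k B c ρ B≐c) (⟦subst⟧ C k B c ρ B≐c)
  ⟦subst⟧ (∀' A)  k B c ρ B≐c =
    ⋀-cong λ d → ≐-trans (⟦subst⟧ A (suc k) B c (d ∷ₑ ρ) (shifted-B≐c d))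
                         (⟦⟧-env-ext A (insert-suc k c ρ d))
    where
    shifted-B≐c : ∀ d → ⟦ shiftN (suc k) B ⟧ (d ∷ₑ ρ) ≐ ⟪ c ⟫
    shifted-B≐c d = ≐-trans (⟦shift⟧ (shiftN k B) 0 (d ∷ₑ ρ)) B≐c

  ⟦instantiate⟧ : ∀ A B {c ρ} → ⟦ B ⟧ ρ ≐ ⟪ c ⟫ → ⟦ A [ B ] ⟧ ρ ≐ ⟦ A ⟧ (c ∷ₑ ρ)
  ⟦instantiate⟧ A B {c} {ρ} B≐c = ≐-trans (⟦subst⟧ A 0 B c ρ B≐c) (⟦⟧-env-ext A insert-zero)
    where
    insert-zero : ∀ n → insert 0 c ρ n ≡ (c ∷ₑ ρ) n
    insert-zero zero    = refl
    insert-zero (suc n) = refl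

  Admissible : Sys → Set
  Admissible F  = ⊤
  Admissible FC = Symmetric _≼_

  sound : ∀ {s Γ A} → Admissible s → Γ ⊢[ s ] A →
          ∀ ρ w → All (λ B → ⟦ B ⟧ ρ w) Γ → ⟦ A ⟧ ρ w
  sound adm (ax A∈Γ) ρ w γ = All.lookup γ A∈Γ
  sound adm (⇒I d)   ρ w γ = λ w≼w′ a →
    sound adm d ρ _ (a All.∷ All.map (λ {B} → ⟦⟧-upward B ρ w≼w′) γ)
  sound adm (⇒E d e) ρ w γ = sound adm d ρ w γ ≼-refl (sound adm e ρ w γ)
  sound adm (∀I d)   ρ w γ = λ c →
    sound adm d (c ∷ₑ ρ) w (map⁺ (All.map (λ {B} → proj₂ (⟦shift⟧ B 0 (c ∷ₑ ρ))) γ))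
  -- The code of ⟦ B ⟧ ρ is only available under ¬¬, hence the detour through stability.
  sound adm (∀E {A = A} d B) ρ w γ =
    ⟦⟧-stable (A [ B ]) ρ w λ ¬goal →
      comprehension (⟦ B ⟧ ρ) (⟦⟧-upward B ρ) λ (c , B≐c) →
        ¬goal (proj₂ (⟦instantiate⟧ A B B≐c) (sound adm d ρ w γ c))
  sound sym (¬¬E {A = A} d) ρ w γ =
    ⟦⟧-stable A ρ w λ ¬a →
      sound {FC} sym d ρ w γ ≼-refl λ w≼w′ a → ¬a (⟦⟧-upward A ρ (sym w≼w′) a)

upset-principal : ∀ {p : Pred ℕ 0ℓ} → p Respects _≤_ →
                  ∀ n → p n → ¬ ¬ (Σ ℕ λ m → p ≐ (m ≤_))
upset-principal p-up zero    p0 = pure (0 , (λ {_} _ → z≤n) , (λ {_} 0≤w → p-up 0≤w p0))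
upset-principal p-up (suc n) p1+n = ¬¬-excluded-middle >>= λ where
  (yes pn) → upset-principal p-up n pn
  (no ¬pn) → pure (suc n , (λ {_} pw → ≰⇒> λ w≤n → ¬pn (p-up w≤n pw))
                         , (λ {_} 1+n≤w → p-up 1+n≤w p1+n))

principal-or-empty : Maybe ℕ → Pred ℕ 0ℓ
principal-or-empty (just m) = m ≤_
principal-or-empty nothing  = ∅

ℕ-frame : Frame
ℕ-frame = record
  { World         = ℕ
  ; _≼_           = _≤_
  ; ≼-refl        = ≤-refl
  ; ≼-trans       = ≤-trans
  ; Code          = Maybe ℕ
  ; ⟪_⟫           = principal-or-empty
  ; ⟪⟫-upward     = upward
  ; ⟪⟫-stable     = stable
  ; comprehension = comprehension
  }
  where
  upward : ∀ c → principal-or-empty c Respects _≤_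
  upward (just m) w≤w′ m≤w = ≤-trans m≤w w≤w′
  upward nothing  w≤w′ ()

  stable : ∀ c → Stable (principal-or-empty c)
  stable (just m) w = decidable-stable (m ≤? w)
  stable nothing  _ ¬¬⊥ = ¬¬⊥ λ ()

  comprehension : (p : Pred ℕ 0ℓ) → p Respects _≤_ →
                  ¬ ¬ (Σ (Maybe ℕ) λ c → p ≐ principal-or-empty c)
  comprehension p p-up = ¬¬-excluded-middle {A = Σ ℕ p} >>= λ where
    (yes (n , pn)) → (λ (m , p≐m≤) → just m , p≐m≤) <$> upset-principal p-up n pn
    (no ¬∃p)       → pure (nothing , (λ {w} pw → ¬∃p (w , pw)) , λ ())

bool-frame : Frame
bool-frame = record
  { World         = ⊤
  ; _≼_           = λ _ _ → ⊤
  ; ≼-refl        = tt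
  ; ≼-trans       = λ _ _ → tt
  ; Code          = Bool
  ; ⟪_⟫           = truth
  ; ⟪⟫-upward     = upward
  ; ⟪⟫-stable     = stable
  ; comprehension = comprehension
  }
  where
  truth : Bool → Pred ⊤ 0ℓ
  truth true  = U
  truth false = ∅

  upward : ∀ b → truth b Respects (λ _ _ → ⊤)
  upward true  _ _  = tt
  upward false _ ()

  stable : ∀ b → Stable (truth b)
  stable true  _ _   = tt
  stable false _ ¬¬⊥ = ¬¬⊥ λ ()

  comprehension : (p : Pred ⊤ 0ℓ) → p Respects (λ _ _ → ⊤) →
                  ¬ ¬ (Σ Bool λ b → p ≐ truth b)
  comprehension p p-up = ¬¬-excluded-middle >>= λ where
    (yes ptt) → pure (true , (λ {_} _ → tt) , (λ {_} _ → p-up tt ptt))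
    (no ¬ptt) → pure (false , (λ {_} pw → ¬ptt (p-up tt pw)) , λ ())

module ℕ-model = Semantics ℕ-frame
module bool-model = Semantics bool-frame

Q⇒P-unprovable-in-F : ¬ ([] ⊢[ F ] Q ⇒ P)
Q⇒P-unprovable-in-F ⊢Q⇒P = P-fails 0 (sound tt ⊢Q⇒P ρ 0 [] ≤-refl Q-holds)
  where
  open ℕ-model
  ρ : Env
  ρ _ = nothing

  P-fails : ∀ w → ¬ ⟦ P ⟧ ρ w
  P-fails w P-holds = 1+w≰w (P-holds (just (suc w)) nothing ≤-refl premise)
    where
    1+w≰w : ¬ suc w ≤ w
    1+w≰w = <-irrefl refl
    premise : ⟦ (var 1 ⇒ var 0) ⇒ var 1 ⟧ (nothing ∷ₑ just (suc w) ∷ₑ ρ) w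
    premise {w′} w≤w′ X⇒Y = ⊥-elim (X⇒Y (n≤1+n w′) (s≤s w≤w′))

  Q-holds : ⟦ Q ⟧ ρ 0
  Q-holds {w} _ P-holds = ⊥-elim (P-fails w P-holds)

[Q⇒P]⇒Q-unprovable-in-FC : ¬ ([] ⊢[ FC ] (Q ⇒ P) ⇒ Q)
[Q⇒P]⇒Q-unprovable-in-FC ⊢[Q⇒P]⇒Q =
  sound {FC} (λ _ → tt) ⊢[Q⇒P]⇒Q ρ tt [] tt (λ _ _ → P-holds) tt P-holds false
  where
  open bool-model
  ρ : Env
  ρ _ = true

  P-holds : ⟦ P ⟧ ρ tt
  P-holds true  _ _ _       = tt
  P-holds false _ _ premise = premise tt λ _ ()

mainTheorem3 : (¬ ([] ⊢[ F ] Q ⇒ P)) × (¬ ([] ⊢[ FC ] (Q ⇒ P) ⇒ Q))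
mainTheorem3 = Q⇒P-unprovable-in-F , [Q⇒P]⇒Q-unprovable-in-FC
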